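{- Let $G$ be a maximal outerplanar graph with $G\not\cong K_3$. Then $D(G)\leq 2$.
   Context: All graphs are finite, simple and undirected. A maximal outerplanar graph is an outerplanar graph to which no edge can be added while preserving outerplanarity; equivalently, a graph isomorphic to a triangulation of a polygon (it has at least $3$ vertices). A vertex labeling $\phi:V(G)\to\{1,\dots,r\}$ is $r$-distinguishing if the only automorphism of $G$ preserving all vertex labels is the identity. The distinguishing number $D(G)$ is the least $r$ such that $G$ has an $r$-distinguishing vertex labeling. -}

module Defs where

open import Data.Nat using (ℕ; _<_; _≤_; _⊓_; _⊔_)
open import Data.Fin using (Fin; toℕ)
open import Data.Bool using (Bool; true; false)
open import Data.Product using (Σ; ∃; _×_; _,_)
open import Data.Sum using (_⊎_)
open import Relation.Binary.PropositionalEquality using (_≡_; _≢_)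
open import Relation.Nullary using (¬_)
open import Function.Bundles using (_↔_; Inverse)

record Graph (n : ℕ) : Set where
  field
    adj     : Fin n → Fin n → Bool
    sym     : ∀ x y → adj x y ≡ adj y x
    irrefl  : ∀ x → adj x x ≡ false
open Graph public

Iso : ∀ {n m} → Graph n → Graph m → Set
Iso {n} {m} G H =
  Σ (Fin n ↔ Fin m) λ f →
    ∀ x y → adj H (Inverse.to f x) (Inverse.to f y) ≡ adj G x y

Aut : ∀ {n} → Graph n → Set
Aut G = Iso G G

K3 : Graph 3
K3 = record { adj = a ; sym = s ; irrefl = i }
  where
  open import Data.Fin using (_≟_)
  open import Relation.Nullary using (yes; no)
  a : Fin 3 → Fin 3 → Bool
  a x y with x ≟ y
  ... | yes _ = false
  ... | no  _ = true
  s : ∀ x y → a x y ≡ a y x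
  s Fin.zero Fin.zero = _≡_.refl
  s Fin.zero (Fin.suc Fin.zero) = _≡_.refl
  s Fin.zero (Fin.suc (Fin.suc Fin.zero)) = _≡_.refl
  s (Fin.suc Fin.zero) Fin.zero = _≡_.refl
  s (Fin.suc Fin.zero) (Fin.suc Fin.zero) = _≡_.refl
  s (Fin.suc Fin.zero) (Fin.suc (Fin.suc Fin.zero)) = _≡_.refl
  s (Fin.suc (Fin.suc Fin.zero)) Fin.zero = _≡_.refl
  s (Fin.suc (Fin.suc Fin.zero)) (Fin.suc Fin.zero) = _≡_.refl
  s (Fin.suc (Fin.suc Fin.zero)) (Fin.suc (Fin.suc Fin.zero)) = _≡_.refl
  i : ∀ x → a x x ≡ false
  i Fin.zero = _≡_.refl
  i (Fin.suc Fin.zero) = _≡_.refl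
  i (Fin.suc (Fin.suc Fin.zero)) = _≡_.refl

-- Two chords {a,b} and {c,d} of a convex polygon whose corners are numbered
-- 0,…,n-1 in cyclic order cross (in their interiors) iff their endpoints
-- strictly interleave.
Cross : ℕ → ℕ → ℕ → ℕ → Set
Cross a b c d =
  let a' = a ⊓ b ; b' = a ⊔ b ; c' = c ⊓ d ; d' = c ⊔ d in
  (a' < c' × c' < b' × b' < d') ⊎ (c' < a' × a' < d' × d' < b')

-- G is a maximal outerplanar graph: n ≥ 3 and G is (isomorphic to) a
-- triangulation of a convex n-gon, i.e. there is a placement σ of the
-- vertices on the corners of the polygon (in cyclic order) such that the
-- edges, drawn as straight chords, are pairwise non-crossing, and the edge
-- set is maximal with this property (every non-adjacent pair of distinct
-- vertices would cross some edge).  Maximality forces all polygon sides to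
-- be edges, since sides cross no chord.
MaximalOuterplanar : ∀ {n} → Graph n → Set
MaximalOuterplanar {n} G =
  3 ≤ n ×
  Σ (Fin n ↔ Fin n) λ σ →
    let pos : Fin n → ℕ
        pos x = toℕ (Inverse.to σ x) in
    (∀ x y u v → adj G x y ≡ true → adj G u v ≡ true →
       ¬ Cross (pos x) (pos y) (pos u) (pos v))
    ×
    (∀ x y → x ≢ y → adj G x y ≡ false →
       ∃ λ u → ∃ λ v → adj G u v ≡ true × Cross (pos x) (pos y) (pos u) (pos v))

Distinguishing : ∀ {n} (G : Graph n) (r : ℕ) → (Fin n → Fin r) → Set
Distinguishing {n} G r φ =
  ∀ (f : Aut G) →
    (∀ x → φ (Inverse.to (Σ.proj₁ f) x) ≡ φ x) →
    ∀ x → Inverse.to (Σ.proj₁ f) x ≡ x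

-- D(G) ≤ r  iff  G has an r-distinguishing labeling.
DistNumLE : ∀ {n} → Graph n → ℕ → Set
DistNumLE {n} G r = Σ (Fin n → Fin r) λ φ → Distinguishing G r φ

-- Place the vertices of G on the corners 0,…,n-1 of a convex polygon so that the
-- edges are non-crossing chords and no chord can be added.  The proof develops:
--  * the boundary sides (pairs of cyclically consecutive corners) are edges, and
--    each side has at most one apex (a common neighbour of its ends);
--  * every edge spanning at least two sides has an apex strictly inside it, and a
--    chord (an edge that is not a side) also has one outside it, hence two apices;
--  * consequently every automorphism maps sides to sides, so it preserves ear tips
--    (vertices whose two boundary neighbours are adjacent), and it is the identity
--    as soon as it fixes two consecutive corners;
--  * descending through inner apices from the side {0, n-1} yields an ear u z w.
-- For n ≥ 4 the corner w after the ear tip z is not an ear tip, so labelling z and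
-- w by 1 and everything else by 0 forces a label-preserving automorphism to fix
-- z and w, hence everything.  For n = 3 all pairs are sides, so G ≅ K₃.

module Submission where

open import Defs hiding (sym)
open import Data.Nat using (ℕ; zero; suc; _+_; _∸_; _<_; _≤_; z≤n; s≤s; s≤s⁻¹; _≟_; _≤?_; _<?_)
open import Data.Nat.Properties
open import Data.Fin as F using (Fin; toℕ; fromℕ<)
open import Data.Fin.Properties using (toℕ-injective; toℕ<n; toℕ-fromℕ<)
open import Data.Bool using (true) renaming (_≟_ to _≟ᵇ_)
open import Data.Bool.Properties using (¬-not)
open import Data.Product using (∃; ∃₂; _×_; _,_; proj₁; proj₂; swap)
open import Data.Sum using (_⊎_; inj₁; inj₂) renaming (swap to ⊎-swap)
open import Data.Empty using (⊥; ⊥-elim)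
open import Relation.Binary.PropositionalEquality
  using (_≡_; _≢_; refl; sym; trans; cong; subst; subst₂)
open import Function.Bundles using (_↔_; Inverse)
open import Function.Properties.Inverse using (↔-refl)
open import Relation.Nullary using (¬_; Dec; yes; no)
open import Relation.Nullary.Decidable using (_×-dec_; _⊎-dec_)
open import Relation.Unary using (Decidable)
open import Relation.Binary using (tri<; tri≈; tri>)

Straddle : ℕ → ℕ → ℕ → ℕ → Set
Straddle a b c d = a < c × c < b × b < d

straddle⇒cross : ∀ {a b c d} → Straddle a b c d → Cross a b c d
straddle⇒cross {a} {b} {c} {d} s@(a<c , c<b , b<d)
  rewrite m≤n⇒m⊓n≡m (<⇒≤ (<-trans a<c c<b)) | m≤n⇒m⊔n≡n (<⇒≤ (<-trans a<c c<b))
        | m≤n⇒m⊓n≡m (<⇒≤ (<-trans c<b b<d)) | m≤n⇒m⊔n≡n (<⇒≤ (<-trans c<b b<d)) = inj₁ s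

cross⇒straddle : ∀ {a b c d} → a < b → c < d → Cross a b c d →
                 Straddle a b c d ⊎ Straddle c d a b
cross⇒straddle {a} {b} {c} {d} a<b c<d x
  rewrite m≤n⇒m⊓n≡m (<⇒≤ a<b) | m≤n⇒m⊔n≡n (<⇒≤ a<b)
        | m≤n⇒m⊓n≡m (<⇒≤ c<d) | m≤n⇒m⊔n≡n (<⇒≤ c<d) = x

cross-flip : ∀ {a b c d} → Cross a b c d → Cross a b d c
cross-flip {a} {b} {c} {d} x rewrite ⊓-comm d c | ⊔-comm d c = x

noneBetween : ∀ {a b c} → suc a ≡ c → a < b → b < c → ⊥
noneBetween refl a<b b<c = <⇒≱ a<b (s≤s⁻¹ b<c)

-- Width bookkeeping for recursions that pass from a chord to a sub-chord.
narrowRight : ∀ {a b c} f → b < c → c ≤ a + suc f → b ≤ a + f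
narrowRight {a} f b<c c≤ = s≤s⁻¹ (≤-trans b<c (≤-trans c≤ (≤-reflexive (+-suc a f))))

narrowLeft : ∀ {a b c} f → a < b → c ≤ a + suc f → c ≤ b + f
narrowLeft {a} f a<b c≤ = ≤-trans c≤ (≤-trans (≤-reflexive (+-suc a f)) (+-monoˡ-≤ f a<b))

largestBelow : ∀ {P : ℕ → Set} → Decidable P → ∀ {a b} → a < b → P a →
               ∃ λ k → a ≤ k × k < b × P k × (∀ j → k < j → j < b → ¬ P j)
largestBelow {P} P? {a} {suc b} a<sb pa with P? b
... | yes pb = b , s≤s⁻¹ a<sb , ≤-refl , pb , λ j b<j j<sb _ → <⇒≱ b<j (s≤s⁻¹ j<sb)
... | no ¬pb with m≤n⇒m<n∨m≡n (s≤s⁻¹ a<sb)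
...   | inj₂ refl = ⊥-elim (¬pb pa)
...   | inj₁ a<b with largestBelow P? a<b pa
...     | k , a≤k , k<b , pk , above = k , a≤k , <-trans k<b ≤-refl , pk , above′
  where
  above′ : ∀ j → k < j → j < suc b → ¬ P j
  above′ j k<j j<sb with m≤n⇒m<n∨m≡n (s≤s⁻¹ j<sb)
  ... | inj₁ j<b = above j k<j j<b
  ... | inj₂ refl = ¬pb

module Spread {ℓ} {n : ℕ} (F : ℕ → Set ℓ)
  (forwardStep  : ∀ {r} → suc (suc r) < n → F r → F (suc r) → F (suc (suc r)))
  (backwardStep : ∀ {r} → suc (suc r) < n → F (suc r) → F (suc (suc r)) → F r)
  {p : ℕ} (p+1<n : suc p < n) (Fp : F p) (Fp+1 : F (suc p)) where

  forward : ∀ d → suc (p + d) < n → F (p + d) × F (suc (p + d))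
  forward zero _ rewrite +-identityʳ p = Fp , Fp+1
  forward (suc d) h rewrite +-suc p d with forward d (<-trans (n<1+n _) h)
  ... | Fr , Fr+1 = Fr+1 , forwardStep h Fr Fr+1

  backward : ∀ d r → r + d ≡ p → F r × F (suc r)
  backward zero r e rewrite +-identityʳ r | e = Fp , Fp+1
  backward (suc d) r e with backward d (suc r) (trans (sym (+-suc r d)) e)
  ... | Fr+1 , Fr+2 = backwardStep r+2<n Fr+1 Fr+2 , Fr+1
    where
    r+2<n : suc (suc r) < n
    r+2<n = ≤-<-trans (s≤s (subst (suc r ≤_) (trans (sym (+-suc r d)) e) (m≤m+n (suc r) d))) p+1<n

  everywhere : ∀ q → q < n → F q
  everywhere q q<n with q ≤? p
  ... | yes q≤p = proj₁ (backward (p ∸ q) q (m+[n∸m]≡n q≤p))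
  ... | no q≰p = subst F e (proj₂ (forward (q ∸ suc p) (subst (_< n) (sym e) q<n)))
    where
    e : suc (p + (q ∸ suc p)) ≡ q
    e = m+[n∸m]≡n (≰⇒> q≰p)

pairLabel : ∀ {n} → Fin n → Fin n → Fin n → Fin 2
pairLabel a b x with x F.≟ a | x F.≟ b
... | yes _ | _     = F.suc F.zero
... | no _  | yes _ = F.suc F.zero
... | no _  | no _  = F.zero

pairLabel-marked : ∀ {n} {a b : Fin n} x → pairLabel a b x ≡ F.suc F.zero → x ≡ a ⊎ x ≡ b
pairLabel-marked {a = a} {b} x _ with x F.≟ a | x F.≟ b
pairLabel-marked x _  | yes x≡a | _      = inj₁ x≡a
pairLabel-marked x _  | no _    | yes x≡b = inj₂ x≡b
pairLabel-marked x () | no _    | no _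

pairLabel-first : ∀ {n} (a b : Fin n) → pairLabel a b a ≡ F.suc F.zero
pairLabel-first a b with a F.≟ a
... | yes _ = refl
... | no a≢a = ⊥-elim (a≢a refl)

pairLabel-second : ∀ {n} (a b : Fin n) → pairLabel a b b ≡ F.suc F.zero
pairLabel-second a b with b F.≟ a | b F.≟ b
... | yes _ | _     = refl
... | no _  | yes _ = refl
... | no _  | no b≢b = ⊥-elim (b≢b refl)

module Polygon {m : ℕ} (G : Graph (3 + m)) (mo : MaximalOuterplanar G) where

  n : ℕ
  n = 3 + m

  V : Set
  V = Fin n

  σ : V ↔ V
  σ = proj₁ (proj₂ mo)

  pos : V → ℕ
  pos x = toℕ (Inverse.to σ x)

  E : V → V → Set
  E x y = adj G x y ≡ true

  E-sym : ∀ {x y} → E x y → E y x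
  E-sym {x} {y} e = trans (Graph.sym G y x) e

  E? : ∀ x y → Dec (E x y)
  E? x y = adj G x y ≟ᵇ true

  pos<n : ∀ x → pos x < n
  pos<n x = toℕ<n _

  pos-injective : ∀ {x y} → pos x ≡ pos y → x ≡ y
  pos-injective {x} {y} eq = trans (sym (Inverse.strictlyInverseʳ σ x))
    (trans (cong (Inverse.from σ) (toℕ-injective eq)) (Inverse.strictlyInverseʳ σ y))

  E⇒pos≢ : ∀ {x y} → E x y → pos x ≢ pos y
  E⇒pos≢ {x} e eq with trans (sym e) (subst (λ t → adj G x t ≡ _) (pos-injective eq) (irrefl G x))
  ... | ()

  E-pos : ∀ {x x′ y y′} → pos x ≡ pos x′ → pos y ≡ pos y′ → E x′ y′ → E x y
  E-pos px py = subst₂ E (sym (pos-injective px)) (sym (pos-injective py))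

  vtx : (p : ℕ) → p < n → V
  vtx p h = Inverse.from σ (fromℕ< h)

  pos-vtx : ∀ p (h : p < n) → pos (vtx p h) ≡ p
  pos-vtx p h = trans (cong toℕ (Inverse.strictlyInverseˡ σ (fromℕ< h))) (toℕ-fromℕ< h)

  noCross : ∀ {x y u v} → E x y → E u v → Straddle (pos x) (pos y) (pos u) (pos v) → ⊥
  noCross {x} {y} {u} {v} exy euv s = proj₁ (proj₂ (proj₂ mo)) x y u v exy euv (straddle⇒cross s)

  crossedBy : ∀ {x y} → ¬ E x y → pos x < pos y → ∃₂ λ u v → E u v ×
              (Straddle (pos x) (pos y) (pos u) (pos v) ⊎ Straddle (pos u) (pos v) (pos x) (pos y))
  crossedBy {x} {y} ¬exy x<y
    with proj₂ (proj₂ (proj₂ mo)) x y (λ x≡y → <⇒≢ x<y (cong pos x≡y)) (¬-not ¬exy)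
  ... | u , v , euv , x with <-cmp (pos u) (pos v)
  ... | tri< u<v _ _ = u , v , euv , cross⇒straddle x<y u<v x
  ... | tri≈ _ u≡v _ = ⊥-elim (E⇒pos≢ euv u≡v)
  ... | tri> _ _ v<u = v , u , E-sym euv , cross⇒straddle x<y v<u (cross-flip x)

  Next : ℕ → ℕ → Set
  Next p q = suc p ≡ q ⊎ (q ≡ 0 × suc p ≡ n)

  next-unique : ∀ {p q q′} → q < n → q′ < n → Next p q → Next p q′ → q ≡ q′
  next-unique _   _    (inj₁ e)        (inj₁ e′)        = trans (sym e) e′
  next-unique q<n _    (inj₁ e)        (inj₂ (_ , e′))  = ⊥-elim (<⇒≢ q<n (trans (sym e) e′))
  next-unique _   q′<n (inj₂ (_ , e))  (inj₁ e′)        = ⊥-elim (<⇒≢ q′<n (trans (sym e′) e))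
  next-unique _   _    (inj₂ (q0 , _)) (inj₂ (q′0 , _)) = trans q0 (sym q′0)

  following : ∀ x → ∃ λ t → Next (pos x) (pos t)
  following x with suc (pos x) <? n
  ... | yes h = vtx _ h , inj₁ (sym (pos-vtx _ h))
  ... | no h  = vtx 0 (s≤s z≤n) , inj₂ (pos-vtx 0 (s≤s z≤n) , ≤∧≮⇒≡ (pos<n x) h)

  Side : V → V → Set
  Side x y = Next (pos x) (pos y) ⊎ Next (pos y) (pos x)

  Side? : ∀ x y → Dec (Side x y)
  Side? x y = next? (pos x) (pos y) ⊎-dec next? (pos y) (pos x)
    where
    next? : ∀ p q → Dec (Next p q)
    next? p q = (suc p ≟ q) ⊎-dec ((q ≟ 0) ×-dec (suc p ≟ n))

  sideNeighbours : ∀ {y v r} → Side y v → pos y ≡ suc r → pos v ≡ r ⊎ Next (pos y) (pos v)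
  sideNeighbours (inj₁ nx)              _  = inj₂ nx
  sideNeighbours (inj₂ (inj₁ e))        py = inj₁ (suc-injective (trans e py))
  sideNeighbours (inj₂ (inj₂ (y0 , _))) py with () <- trans (sym y0) py

  middleNeighbours : ∀ {y v r} → Side y v → pos y ≡ suc r → suc (suc r) < n →
                     pos v ≡ r ⊎ pos v ≡ suc (suc r)
  middleNeighbours s py r+2<n with sideNeighbours s py
  ... | inj₁ e  = inj₁ e
  ... | inj₂ nx = inj₂ (next-unique (pos<n _) r+2<n nx (inj₁ (cong suc py)))

  middleSide : ∀ {y v r} → pos y ≡ suc r → pos v ≡ r ⊎ pos v ≡ suc (suc r) → Side y v
  middleSide py (inj₁ e) = inj₂ (inj₁ (trans (cong suc e) (sym py)))
  middleSide py (inj₂ e) = inj₁ (inj₁ (trans (cong suc py) (sym e)))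

  consecutiveEdge : ∀ {x y} → suc (pos x) ≡ pos y → E x y
  consecutiveEdge {x} {y} e with E? x y
  ... | yes exy = exy
  ... | no ¬exy with crossedBy ¬exy (≤-reflexive e)
  ...   | _ , _ , _ , inj₁ (x<u , u<y , _) = ⊥-elim (noneBetween e x<u u<y)
  ...   | _ , _ , _ , inj₂ (_ , x<v , v<y) = ⊥-elim (noneBetween e x<v v<y)

  closingEdge : ∀ {x y} → pos x ≡ 0 → suc (pos y) ≡ n → E x y
  closingEdge {x} {y} x0 yl with E? x y
  ... | yes exy = exy
  ... | no ¬exy with crossedBy ¬exy (subst₂ _<_ (sym x0) (sym (suc-injective yl)) (s≤s z≤n))
  ...   | _ , v , _ , inj₁ (_ , _ , y<v) = ⊥-elim (noneBetween yl y<v (pos<n v))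
  ...   | _ , _ , _ , inj₂ (u<x , _ , _) = ⊥-elim (n≮0 (subst (_ <_) x0 u<x))

  nextEdge : ∀ {x y} → Next (pos x) (pos y) → E x y
  nextEdge (inj₁ e)         = consecutiveEdge e
  nextEdge (inj₂ (y0 , xl)) = E-sym (closingEdge y0 xl)

  sideEdge : ∀ {x y} → Side x y → E x y
  sideEdge (inj₁ nx) = nextEdge nx
  sideEdge (inj₂ nx) = E-sym (nextEdge nx)

  Apex : V → V → V → Set
  Apex x y a = E x a × E y a

  TwoApices : V → V → Set
  TwoApices x y = ∃₂ λ a b → a ≢ b × Apex x y a × Apex x y b

  twoApices-swap : ∀ {x y} → TwoApices x y → TwoApices y x
  twoApices-swap (a , b , a≢b , ap , bp) = a , b , a≢b , swap ap , swap bp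

  apexOutside : ∀ {x y a} → suc (pos x) ≡ pos y → Apex x y a → pos a < pos x ⊎ pos y < pos a
  apexOutside {x} {y} {a} e (exa , eya) with <-cmp (pos a) (pos x)
  ... | tri< a<x _ _ = inj₁ a<x
  ... | tri≈ _ a≡x _ = ⊥-elim (E⇒pos≢ exa (sym a≡x))
  ... | tri> _ _ x<a = inj₂ (≤∧≢⇒< (subst (_≤ pos a) e x<a) (E⇒pos≢ eya))

  -- A side has at most one apex: two would give crossing edges.
  consecutiveOneApex : ∀ {x y a b} → suc (pos x) ≡ pos y →
                       Apex x y a → Apex x y b → pos a < pos b → ⊥
  consecutiveOneApex {x} {y} e ap@(exa , eya) bp@(exb , eyb) a<b
    with apexOutside e ap | apexOutside e bp
  ... | inj₁ a<x | inj₁ b<x = noCross (E-sym exa) (E-sym eyb) (a<b , b<x , ≤-reflexive e)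
  ... | inj₁ a<x | inj₂ y<b = noCross (E-sym eya) exb (a<x , ≤-reflexive e , y<b)
  ... | inj₂ y<a | inj₁ b<x = <-asym a<b (<-trans b<x (<-trans (≤-reflexive e) y<a))
  ... | inj₂ y<a | inj₂ y<b = noCross exa eyb (≤-reflexive e , y<a , a<b)

  closingOneApex : ∀ {x y a b} → pos x ≡ 0 → suc (pos y) ≡ n →
                   Apex x y a → Apex x y b → pos a < pos b → ⊥
  closingOneApex {x} {y} {a} {b} x0 yl (exa , eya) (exb , eyb) a<b =
    noCross exb (E-sym eya) (x<a , a<b , b<y)
    where
    x<a : pos x < pos a
    x<a = ≤∧≢⇒< (subst (_≤ pos a) (sym x0) z≤n) (E⇒pos≢ exa)
    b<y : pos b < pos y
    b<y = ≤∧≢⇒< (s≤s⁻¹ (subst (pos b <_) (sym yl) (pos<n b))) (λ b≡y → E⇒pos≢ eyb (sym b≡y))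

  nextOneApex : ∀ {x y} → Next (pos x) (pos y) → ¬ TwoApices x y
  nextOneApex nx (a , b , a≢b , ap , bp) with <-cmp (pos a) (pos b) | nx
  ... | tri≈ _ a≡b _ | _                = a≢b (pos-injective a≡b)
  ... | tri< a<b _ _ | inj₁ e           = consecutiveOneApex e ap bp a<b
  ... | tri> _ _ b<a | inj₁ e           = consecutiveOneApex e bp ap b<a
  ... | tri< a<b _ _ | inj₂ (y0 , xl)   = closingOneApex y0 xl (swap ap) (swap bp) a<b
  ... | tri> _ _ b<a | inj₂ (y0 , xl)   = closingOneApex y0 xl (swap bp) (swap ap) b<a

  sideOneApex : ∀ {x y} → Side x y → ¬ TwoApices x y
  sideOneApex (inj₁ nx) two = nextOneApex nx two
  sideOneApex (inj₂ nx) two = nextOneApex nx (twoApices-swap two)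

  NeighbourAt : V → ℕ → Set
  NeighbourAt x j = ∃ λ v → pos v ≡ j × E x v

  neighbourAt? : ∀ x → Decidable (NeighbourAt x)
  neighbourAt? x j with j <? n
  ... | no j≮n = no λ (v , pv , _) → j≮n (subst (_< n) pv (pos<n v))
  ... | yes j<n with E? x (vtx j j<n)
  ...   | yes e  = yes (vtx j j<n , pos-vtx j j<n , e)
  ...   | no ¬e  = no λ (v , pv , e) →
                     ¬e (subst (E x) (pos-injective (trans pv (sym (pos-vtx j j<n)))) e)

  -- An edge spanning at least two sides has an apex strictly inside it: the last
  -- neighbour k of x before y must be adjacent to y, or an edge would cross x y or x k.
  innerApex : ∀ {x y} → E x y → suc (suc (pos x)) ≤ pos y →
              ∃ λ k → pos x < pos k × pos k < pos y × Apex x y k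
  innerApex {x} {y} exy x+2≤y
    with largestBelow (neighbourAt? x) x+2≤y successor
    where
    x+1<n : suc (pos x) < n
    x+1<n = <-≤-trans x+2≤y (<⇒≤ (pos<n y))
    successor : NeighbourAt x (suc (pos x))
    successor = vtx _ x+1<n , pos-vtx _ x+1<n , consecutiveEdge (sym (pos-vtx _ x+1<n))
  ... | j , x<j , j<y , (k , pk , exk) , above
    rewrite sym pk with E? y k
  ... | yes eyk = k , x<j , j<y , exk , eyk
  ... | no ¬eyk with crossedBy (λ eky → ¬eyk (E-sym eky)) j<y
  ...   | u , v , euv , inj₁ (k<u , u<y , y<v) = ⊥-elim (noCross exy euv (<-trans x<j k<u , u<y , y<v))
  ...   | u , v , euv , inj₂ (u<k , k<v , v<y) with <-cmp (pos u) (pos x)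
  ...     | tri< u<x _ _ = ⊥-elim (noCross euv exy (u<x , <-trans x<j k<v , v<y))
  ...     | tri≈ _ u≡x _ = ⊥-elim (above (pos v) k<v v<y (v , refl , E-pos (sym u≡x) refl euv))
  ...     | tri> _ _ x<u = ⊥-elim (noCross exk euv (x<u , u<k , k<v))

  apexNotInside : ∀ {A B k x y} → Apex A B k → E x y → pos A ≤ pos x → pos y ≤ pos B →
                  ¬ (pos x ≡ pos A × pos y ≡ pos B) → pos x < pos k → pos k < pos y → ⊥
  apexNotInside (eAk , eBk) exy A≤x y≤B ≢AB x<k k<y with m≤n⇒m<n∨m≡n A≤x
  ... | inj₁ A<x = noCross eAk exy (A<x , x<k , k<y)
  ... | inj₂ A≡x with m≤n⇒m<n∨m≡n y≤B
  ...   | inj₁ y<B = noCross exy (E-sym eBk) (x<k , k<y , y<B)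
  ...   | inj₂ y≡B = ≢AB (sym A≡x , y≡B)

  -- A chord x y enclosed by an edge A B ≠ x y has an apex outside it.  Descend from
  -- A B through inner apices until x y is a side of the triangle; f bounds the width.
  outerApex : ∀ f {A B x y} → E A B → pos B ≤ pos A + f → pos A ≤ pos x → pos y ≤ pos B →
              ¬ (pos x ≡ pos A × pos y ≡ pos B) → suc (suc (pos x)) ≤ pos y → E x y →
              ∃ λ l → Apex x y l × (pos l < pos x ⊎ pos y < pos l)
  outerApex zero {A} _ B≤ A≤x y≤B _ x+2≤y _ =
    ⊥-elim (<⇒≱ (≤-trans (s≤s A≤x) (≤-trans (≤-trans (n≤1+n _) x+2≤y) y≤B))
                (subst (_ ≤_) (+-identityʳ (pos A)) B≤))
  outerApex (suc f) {A} {B} {x} {y} eAB B≤ A≤x y≤B ≢AB x+2≤y exy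
    with innerApex eAB (≤-trans (s≤s (s≤s A≤x)) (≤-trans x+2≤y y≤B))
  ... | k , A<k , k<B , kp@(eAk , eBk) with pos y ≤? pos k | pos k ≤? pos x
  -- x y lies under A k: it is that side (apex B), or recurse into A k.
  ...   | yes y≤k | _ with (pos x ≟ pos A) ×-dec (pos y ≟ pos k)
  ...     | yes (x≡A , y≡k) =
    B , (E-pos x≡A refl eAB , E-pos y≡k refl (E-sym eBk)) ,
    inj₂ (subst (_< pos B) (sym y≡k) k<B)
  ...     | no ≢Ak = outerApex f eAk (narrowRight f k<B B≤) A≤x y≤k ≢Ak x+2≤y exy
  -- x y lies under k B: it is that side (apex A), or recurse into k B.
  outerApex (suc f) {A} {B} {x} {y} eAB B≤ A≤x y≤B ≢AB x+2≤y exy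
      | k , A<k , k<B , (eAk , eBk) | no _ | yes k≤x with (pos x ≟ pos k) ×-dec (pos y ≟ pos B)
  ...     | yes (x≡k , y≡B) =
    A , (E-pos x≡k refl (E-sym eAk) , E-pos y≡B refl (E-sym eAB)) ,
    inj₁ (subst (pos A <_) (sym x≡k) A<k)
  ...     | no ≢kB = outerApex f (E-sym eBk) (narrowLeft f A<k B≤) k≤x y≤B ≢kB x+2≤y exy
  -- Otherwise k would lie strictly inside x y.
  outerApex (suc f) eAB B≤ A≤x y≤B ≢AB x+2≤y exy
      | k , _ , _ , kp | no y≰k | no k≰x =
    ⊥-elim (apexNotInside kp exy A≤x y≤B ≢AB (≰⇒> k≰x) (≰⇒> y≰k))

  first : V
  first = vtx 0 (s≤s z≤n)

  last : V
  last = vtx (suc (suc m)) ≤-refl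

  pos-first : pos first ≡ 0
  pos-first = pos-vtx 0 (s≤s z≤n)

  pos-last : pos last ≡ suc (suc m)
  pos-last = pos-vtx _ ≤-refl

  firstLast : E first last
  firstLast = closingEdge pos-first (cong suc pos-last)

  withinBound : ∀ x → pos x ≤ pos first + n
  withinBound x = subst (pos x ≤_) (cong (_+ n) (sym pos-first)) (<⇒≤ (pos<n x))

  chordWide : ∀ {x y} → pos x < pos y → ¬ Side x y → suc (suc (pos x)) ≤ pos y
  chordWide x<y ¬side = ≤∧≢⇒< x<y (λ e → ¬side (inj₁ (inj₁ e)))

  chordNotClosing : ∀ {x y} → ¬ Side x y → ¬ (pos x ≡ pos first × pos y ≡ pos last)
  chordNotClosing ¬side (x≡ , y≡) =
    ¬side (inj₂ (inj₂ (trans x≡ pos-first , cong suc (trans y≡ pos-last))))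

  orderedChordTwoApices : ∀ {x y} → E x y → pos x < pos y → ¬ Side x y → TwoApices x y
  orderedChordTwoApices {x} {y} exy x<y ¬side =
    distinctApices (innerApex exy (chordWide x<y ¬side))
      (outerApex n firstLast (withinBound last) (subst (_≤ pos x) (sym pos-first) z≤n)
                 (subst (pos y ≤_) (sym pos-last) (s≤s⁻¹ (pos<n y)))
                 (chordNotClosing ¬side) (chordWide x<y ¬side) exy)
    where
    distinctApices : (∃ λ k → pos x < pos k × pos k < pos y × Apex x y k) →
                     (∃ λ l → Apex x y l × (pos l < pos x ⊎ pos y < pos l)) → TwoApices x y
    distinctApices (k , x<k , k<y , kp) (l , lp , inj₁ l<x) =
      k , l , (λ k≡l → <⇒≢ (<-trans l<x x<k) (sym (cong pos k≡l))) , kp , lp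
    distinctApices (k , x<k , k<y , kp) (l , lp , inj₂ y<l) =
      k , l , (λ k≡l → <⇒≢ (<-trans k<y y<l) (cong pos k≡l)) , kp , lp

  chordTwoApices : ∀ {x y} → E x y → ¬ Side x y → TwoApices x y
  chordTwoApices {x} {y} exy ¬side with <-cmp (pos x) (pos y)
  ... | tri< x<y _ _ = orderedChordTwoApices exy x<y ¬side
  ... | tri≈ _ x≡y _ = ⊥-elim (E⇒pos≢ exy x≡y)
  ... | tri> _ _ y<x = twoApices-swap (orderedChordTwoApices (E-sym exy) y<x (λ s → ¬side (⊎-swap s)))

  -- Descending through inner apices from an edge spanning at least two sides
  -- reaches an ear: an edge u w cutting off the single corner between them.
  earBelow : ∀ f {x y} → E x y → suc (suc (pos x)) ≤ pos y → pos y ≤ pos x + f →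
             ∃₂ λ u w → E u w × pos w ≡ suc (suc (pos u))
  earBelow zero {x} _ x+2≤y y≤ =
    ⊥-elim (<⇒≱ (≤-trans (n≤1+n _) x+2≤y) (subst (_ ≤_) (+-identityʳ (pos x)) y≤))
  earBelow (suc f) {x} {y} exy x+2≤y y≤ with innerApex exy x+2≤y
  ... | k , x<k , k<y , (exk , eyk) with pos k ≟ suc (pos x) | pos y ≟ suc (pos k)
  ...   | no k≢ | _ = earBelow f exk (≤∧≢⇒< x<k (λ e → k≢ (sym e))) (narrowRight f k<y y≤)
  ...   | yes k≡ | no y≢ = earBelow f (E-sym eyk) (≤∧≢⇒< k<y (λ e → y≢ (sym e))) (narrowLeft f x<k y≤)
  ...   | yes k≡ | yes y≡ = x , y , exy , trans y≡ (cong suc k≡)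

  earExists : ∃₂ λ u w → E u w × pos w ≡ suc (suc (pos u))
  earExists = earBelow n firstLast
    (subst₂ (λ a b → suc (suc a) ≤ b) (sym pos-first) (sym pos-last) (s≤s (s≤s z≤n)))
    (withinBound last)

  EarTip : V → Set
  EarTip z = ∃₂ λ a b → a ≢ b × Side z a × Side z b × E a b

  module Automorphism (g : Aut G) where

    act : V → V
    act = Inverse.to (proj₁ g)

    act⁻¹ : V → V
    act⁻¹ = Inverse.from (proj₁ g)

    act-act⁻¹ : ∀ u → act (act⁻¹ u) ≡ u
    act-act⁻¹ = Inverse.strictlyInverseˡ (proj₁ g)

    act-injective : ∀ {x y} → act x ≡ act y → x ≡ y
    act-injective {x} {y} eq = trans (sym (Inverse.strictlyInverseʳ (proj₁ g) x))
      (trans (cong act⁻¹ eq) (Inverse.strictlyInverseʳ (proj₁ g) y))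

    E-preserved : ∀ {x y} → E x y → E (act x) (act y)
    E-preserved {x} {y} e = trans (proj₂ g x y) e

    E-pullback : ∀ {x u} → E (act x) u → E x (act⁻¹ u)
    E-pullback {x} {u} e = trans (sym (proj₂ g x (act⁻¹ u))) (subst (E (act x)) (sym (act-act⁻¹ u)) e)

    twoApices-pullback : ∀ {x y} → TwoApices (act x) (act y) → TwoApices x y
    twoApices-pullback (a , b , a≢b , (exa , eya) , (exb , eyb)) =
      act⁻¹ a , act⁻¹ b ,
      (λ e → a≢b (trans (sym (act-act⁻¹ a)) (trans (cong act e) (act-act⁻¹ b)))) ,
      (E-pullback exa , E-pullback eya) , (E-pullback exb , E-pullback eyb)

    -- Sides are exactly the edges with at most one apex, so automorphisms keep them.
    side-preserved : ∀ {x y} → Side x y → Side (act x) (act y)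
    side-preserved {x} {y} s with Side? (act x) (act y)
    ... | yes s′ = s′
    ... | no ¬s′ =
      ⊥-elim (sideOneApex s (twoApices-pullback (chordTwoApices (E-preserved (sideEdge s)) ¬s′)))

    earTip-preserved : ∀ {z} → EarTip z → EarTip (act z)
    earTip-preserved (a , b , a≢b , sa , sb , eab) =
      act a , act b , (λ e → a≢b (act-injective e)) ,
      side-preserved sa , side-preserved sb , E-preserved eab

    Fixed : ℕ → Set
    Fixed r = ∀ v → pos v ≡ r → act v ≡ v

    fixedPreimage : ∀ {r v} → Fixed r → pos (act v) ≡ r → act v ≡ v
    fixedPreimage {v = v} Fr e = act-injective (Fr (act v) e)

    neighbourImage : ∀ {r v} → Fixed (suc r) → suc (suc r) < n →
                     pos v ≡ r ⊎ pos v ≡ suc (suc r) → pos (act v) ≡ r ⊎ pos (act v) ≡ suc (suc r)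
    neighbourImage {r} {v} Fr+1 r+2<n pv =
      middleNeighbours (subst (λ t → Side t (act v)) (Fr+1 y py) (side-preserved (middleSide py pv)))
                       py r+2<n
      where
      y : V
      y = vtx (suc r) (<-trans (n<1+n _) r+2<n)
      py : pos y ≡ suc r
      py = pos-vtx (suc r) (<-trans (n<1+n _) r+2<n)

    forwardStep : ∀ {r} → suc (suc r) < n → Fixed r → Fixed (suc r) → Fixed (suc (suc r))
    forwardStep r+2<n Fr Fr+1 v pv with neighbourImage Fr+1 r+2<n (inj₂ pv)
    ... | inj₁ e = fixedPreimage Fr e
    ... | inj₂ e = pos-injective (trans e (sym pv))

    backwardStep : ∀ {r} → suc (suc r) < n → Fixed (suc r) → Fixed (suc (suc r)) → Fixed r
    backwardStep r+2<n Fr+1 Fr+2 v pv with neighbourImage Fr+1 r+2<n (inj₁ pv)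
    ... | inj₁ e = pos-injective (trans e (sym pv))
    ... | inj₂ e = fixedPreimage Fr+2 e

    fixedAt : ∀ {y} → act y ≡ y → Fixed (pos y)
    fixedAt {y} fy v pv = subst (λ t → act t ≡ t) (sym (pos-injective pv)) fy

    rigid : ∀ {y v} → act y ≡ y → act v ≡ v → pos v ≡ suc (pos y) → ∀ x → act x ≡ x
    rigid {y} {v} fy fv pv x =
      Spread.everywhere Fixed forwardStep backwardStep
        (subst (_< n) pv (pos<n v)) (fixedAt fy) (subst Fixed pv (fixedAt fv)) (pos x) (pos<n x) x refl

module AtLeastFour {m : ℕ} (G : Graph (4 + m)) (mo : MaximalOuterplanar G) where

  open Polygon {suc m} G mo

  module Marked (u w : V) (euw : E u w) (pw′ : pos w ≡ suc (suc (pos u))) where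

    u+2<n : suc (suc (pos u)) < n
    u+2<n = subst (_< n) pw′ (pos<n w)

    z : V
    z = vtx (suc (pos u)) (<-trans (n<1+n _) u+2<n)

    pz : pos z ≡ suc (pos u)
    pz = pos-vtx (suc (pos u)) (<-trans (n<1+n _) u+2<n)

    pw : pos w ≡ suc (pos z)
    pw = trans pw′ (cong suc (sym pz))

    u<z : pos u < pos z
    u<z = ≤-reflexive (sym pz)

    z<w : pos z < pos w
    z<w = ≤-reflexive (sym pw)

    z-earTip : EarTip z
    z-earTip = u , w , (λ u≡w → <⇒≢ (<-trans u<z z<w) (cong pos u≡w)) ,
               inj₂ (inj₁ (sym pz)) , inj₁ (inj₁ (sym pw)) , euw

    -- The corner t after w is not adjacent to z, since z t would cross u w.
    t : V
    t = proj₁ (following w)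

    w→t : Next (pos w) (pos t)
    w→t = proj₂ (following w)

    z≁t : ¬ E z t
    z≁t ezt with w→t
    ... | inj₁ e = noCross euw ezt (u<z , z<w , ≤-reflexive e)
    -- If w is the last corner then t = 0, while u = n - 3 ≥ 1 as n ≥ 4.
    ... | inj₂ (t0 , wl) = noCross (E-sym ezt) euw (t<u , u<z , z<w)
      where
      pu : pos u ≡ suc m
      pu = +-cancelˡ-≡ 3 _ _ (trans (cong (λ k → suc (suc k)) (sym pz)) (trans (cong suc (sym pw)) wl))
      t<u : pos t < pos u
      t<u = subst₂ _<_ (sym t0) (sym pu) (s≤s z≤n)

    -- Hence w, whose boundary neighbours are z and t, is not an ear tip.
    wNeighbour : ∀ {a} → Side w a → a ≡ z ⊎ a ≡ t
    wNeighbour s with sideNeighbours s pw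
    ... | inj₁ e  = inj₁ (pos-injective e)
    ... | inj₂ nx = inj₂ (pos-injective (next-unique (pos<n _) (pos<n t) nx w→t))

    w-notEarTip : ¬ EarTip w
    w-notEarTip (a , b , a≢b , sa , sb , eab) with wNeighbour sa | wNeighbour sb
    ... | inj₁ refl | inj₁ refl = a≢b refl
    ... | inj₁ refl | inj₂ refl = z≁t eab
    ... | inj₂ refl | inj₁ refl = z≁t (E-sym eab)
    ... | inj₂ refl | inj₂ refl = a≢b refl

    label : V → Fin 2
    label = pairLabel z w

    -- A label-preserving automorphism fixes the ear tip z (w is not an ear tip), then w.
    distinguishing : Distinguishing G 2 label
    distinguishing g keeps = rigid fz fw pw
      where
      open Automorphism g
      fz : act z ≡ z
      fz with pairLabel-marked (act z) (trans (keeps z) (pairLabel-first z w))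
      ... | inj₁ e = e
      ... | inj₂ e = ⊥-elim (w-notEarTip (subst EarTip e (earTip-preserved z-earTip)))
      fw : act w ≡ w
      fw with pairLabel-marked (act w) (trans (keeps w) (pairLabel-second z w))
      ... | inj₁ e = ⊥-elim (<⇒≢ z<w (sym (cong pos (act-injective (trans e (sym fz))))))
      ... | inj₂ e = e

  distinguished : DistNumLE G 2
  distinguished = fromEar earExists
    where
    fromEar : (∃₂ λ u w → E u w × pos w ≡ suc (suc (pos u))) → DistNumLE G 2
    fromEar (u , w , euw , pw) = Marked.label u w euw pw , Marked.distinguishing u w euw pw

-- For n = 3 every pair of distinct corners is a side, so G is the triangle.
module Triangle (G : Graph 3) (mo : MaximalOuterplanar G) where

  open Polygon {0} G mo

  cornersAdjacent : ∀ p q → p < 3 → q < 3 → p ≢ q → Next p q ⊎ Next q p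
  cornersAdjacent 0 0 _ _ p≢q = ⊥-elim (p≢q refl)
  cornersAdjacent 0 1 _ _ _   = inj₁ (inj₁ refl)
  cornersAdjacent 0 2 _ _ _   = inj₂ (inj₂ (refl , refl))
  cornersAdjacent 1 0 _ _ _   = inj₂ (inj₁ refl)
  cornersAdjacent 1 1 _ _ p≢q = ⊥-elim (p≢q refl)
  cornersAdjacent 1 2 _ _ _   = inj₁ (inj₁ refl)
  cornersAdjacent 2 0 _ _ _   = inj₁ (inj₂ (refl , refl))
  cornersAdjacent 2 1 _ _ _   = inj₂ (inj₁ refl)
  cornersAdjacent 2 2 _ _ p≢q = ⊥-elim (p≢q refl)
  cornersAdjacent (suc (suc (suc _))) _ (s≤s (s≤s (s≤s ()))) _ _
  cornersAdjacent _ (suc (suc (suc _))) _ (s≤s (s≤s (s≤s ()))) _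

  complete : ∀ x y → x ≢ y → E x y
  complete x y x≢y =
    sideEdge (cornersAdjacent (pos x) (pos y) (pos<n x) (pos<n y) (λ e → x≢y (pos-injective e)))

  isK3 : Iso G K3
  isK3 = ↔-refl , sameAdj
    where
    sameAdj : ∀ x y → adj K3 x y ≡ adj G x y
    sameAdj x y with x F.≟ y
    ... | yes refl = sym (irrefl G x)
    ... | no x≢y   = sym (complete x y x≢y)

mainTheorem4 : ∀ (n : ℕ) (G : Graph n) → MaximalOuterplanar G → ¬ Iso G K3 → DistNumLE G 2
mainTheorem4 0 G (() , _) _
mainTheorem4 1 G (s≤s () , _) _
mainTheorem4 2 G (s≤s (s≤s ()) , _) _
mainTheorem4 3 G mo notK3 = ⊥-elim (notK3 (Triangle.isK3 G mo))
mainTheorem4 (suc (suc (suc (suc m)))) G mo _ = AtLeastFour.distinguished G mo
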